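{- Let $\mathbf A=(A,\cdot,1)$ be an orthomodular implication algebra. For $x,y\in A$ put $x\lor y:=(xy)y$, $x*y:=(x\lor y)y$, and $x\leq y$ iff $xy=1$. Then $(A,\leq,*,1)$ is a skew Hilbert algebra satisfying, for all $x,y,z$: (i) $(x*y)*y=(y*x)*x$; (ii) $(((((((((x*y)*y)*z)*z)*z)*x)*x)*z)*x)*x=(((x*y)*y)*z)*z$. Conversely, if $\mathbf S=(S,\leq,*,1)$ is a skew Hilbert algebra satisfying (i) and (ii), then, setting $x\lor y:=(x*y)*y$ and $x\cdot y:=(x\lor y)*y$, the algebra $(S,\cdot,1)$ is an orthomodular implication algebra.
   Context: An orthomodular implication algebra is an algebra $(A,\cdot,1)$ of type $(2,0)$ (write $xy$ for $x\cdot y$) satisfying for all $x,y,z$: (O1) $xx=1$; (O2) $x(yx)=1$; (O3) $(xy)x=x$; (O4) $(xy)y=(yx)x$; (O5) $(((xy)y)z)(xz)=1$; (O6) $(((((((((xy)y)z)z)z)x)x)z)x)x=(((xy)y)z)z$. For a poset $(P,\leq)$ and $A\subseteq P$ let $L(A)$ (resp. $U(A)$) be the set of all lower (resp. upper) bounds of $A$; $L(U(x,y),z)$ denotes $L(U(\{x,y\})\cup\{z\})$. A skew Hilbert algebra is a poset $(S,\leq,*,1)$ with a binary operation $*$ and constant $1$ such that for all $x,y,z\in S$: (S1) $x\leq y$ iff $x*y=1$; (S2) if $y*x=1$ then $x*((x*y)*y)=1$; (S3) if $x*y=1$ then $(y*z)*(x*z)=1$; (S4) $L(U(x,y),x*y)=L(y)$.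 -}

module Defs where

open import Level using (Level; _⊔_)
open import Relation.Binary.PropositionalEquality using (_≡_)
open import Relation.Binary.Structures using (IsPartialOrder)
open import Data.Product using (_×_)

private
  variable
    a ℓ : Level

record IsOIA {A : Set a} (_·_ : A → A → A) (𝟏 : A) : Set a where
  field
    O1 : ∀ x → x · x ≡ 𝟏
    O2 : ∀ x y → x · (y · x) ≡ 𝟏
    O3 : ∀ x y → (x · y) · x ≡ x
    O4 : ∀ x y → (x · y) · y ≡ (y · x) · x
    O5 : ∀ x y z → (((x · y) · y) · z) · (x · z) ≡ 𝟏
    O6 : ∀ x y z →
      (((((((((x · y) · y) · z) · z) · z) · x) · x) · z) · x) · x
        ≡ (((x · y) · y) · z) · z

module _ {A : Set a} (_≤_ : A → A → Set ℓ) where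
  IsUpperBound₂ : A → A → A → Set ℓ
  IsUpperBound₂ x y u = (x ≤ u) × (y ≤ u)

  InLUz : A → A → A → A → Set (a ⊔ ℓ)
  InLUz x y z w = (∀ u → IsUpperBound₂ x y u → w ≤ u) × (w ≤ z)

record IsSkewHilbert {S : Set a} (_≤_ : S → S → Set ℓ) (_*_ : S → S → S) (𝟏 : S)
       : Set (a ⊔ ℓ) where
  field
    isPartialOrder : IsPartialOrder _≡_ _≤_
    S1→ : ∀ {x y} → x ≤ y → x * y ≡ 𝟏
    S1← : ∀ {x y} → x * y ≡ 𝟏 → x ≤ y
    S2 : ∀ {x y} → y * x ≡ 𝟏 → x * ((x * y) * y) ≡ 𝟏
    S3 : ∀ {x y} z → x * y ≡ 𝟏 → (y * z) * (x * z) ≡ 𝟏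
    -- (S4) L(U(x,y), x*y) = L(y), as equality of subsets of S
    S4→ : ∀ x y w → InLUz _≤_ x y (x * y) w → w ≤ y
    S4← : ∀ x y w → w ≤ y → InLUz _≤_ x y (x * y) w

CondI : {S : Set a} → (S → S → S) → Set a
CondI {S = S} _*_ = ∀ (x y : S) → (x * y) * y ≡ (y * x) * x

CondII : {S : Set a} → (S → S → S) → Set a
CondII {S = S} _*_ = ∀ (x y z : S) →
  (((((((((x * y) * y) * z) * z) * z) * x) * x) * z) * x) * x
    ≡ (((x * y) * y) * z) * z

module FromOIA {A : Set a} (_·_ : A → A → A) (𝟏 : A) where
  _∨_ : A → A → A
  x ∨ y = (x · y) · y
  _*_ : A → A → A
  x * y = (x ∨ y) · y
  _≤_ : A → A → Set a
  x ≤ y = x · y ≡ 𝟏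

module FromSkew {S : Set a} (_*_ : S → S → S) where
  _∨_ : S → S → S
  x ∨ y = (x * y) * y
  _·_ : S → S → S
  x · y = (x ∨ y) * y

-- In an orthomodular implication algebra the derived operation x * y = ((xy)y)y
-- collapses to xy, because ((xy)y)y = (y(xy))(xy) = 1(xy) by (O4) and (O2).
-- Dually, in a skew Hilbert algebra satisfying (i) the operation x · y = ((x*y)*y)*y
-- collapses to x * y. So each direction reduces to checking the other system's axioms
-- for one and the same operation, and then transporting them along a pointwise equality.
module Submission where

open import Defs
open import Level using (Level)
open import Data.List using ([]; _∷_; foldl)
open import Data.List.Properties using (foldl-cong)
open import Data.Product using (_×_; _,_; proj₂)
open import Relation.Binary.PropositionalEquality
  using (_≡_; refl; sym; trans; cong; cong₂; subst; isEquivalence; module ≡-Reasoning)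
open import Relation.Binary.Structures using (IsPartialOrder)

module _ {a : Level} {A : Set a} {f g : A → A → A} (f≗g : ∀ x y → f x y ≡ g x y) where

  private
    -- Left-nested terms ((x ∘ w₁) ∘ w₂) ∘ ⋯ are exactly foldl's.
    nest : ∀ x ws → foldl f x ws ≡ foldl g x ws
    nest = foldl-cong f≗g

  condI-resp : CondI f → CondI g
  condI-resp condI x y =
    trans (sym (nest x (y ∷ y ∷ []))) (trans (condI x y) (nest y (x ∷ x ∷ [])))

  condII-resp : CondII f → CondII g
  condII-resp condII x y z =
    trans (sym (nest x (y ∷ y ∷ z ∷ z ∷ z ∷ x ∷ x ∷ z ∷ x ∷ x ∷ [])))
          (trans (condII x y z) (nest x (y ∷ y ∷ z ∷ z ∷ [])))

  isOIA-resp : ∀ {𝟏} → IsOIA f 𝟏 → IsOIA g 𝟏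
  isOIA-resp isOIA = record
    { O1 = λ x → trans (sym (f≗g x x)) (O1 x)
    ; O2 = λ x y → trans (sym (f≗g x (g y x))) (trans (cong (f x) (sym (f≗g y x))) (O2 x y))
    ; O3 = λ x y → trans (sym (nest x (y ∷ x ∷ []))) (O3 x y)
    ; O4 = condI-resp O4
    ; O5 = λ x y z →
        trans (sym (cong₂ g (nest x (y ∷ y ∷ z ∷ [])) (f≗g x z)))
              (trans (sym (f≗g _ _)) (O5 x y z))
    ; O6 = condII-resp O6
    }
    where open IsOIA isOIA

  isSkewHilbert-resp : ∀ {ℓ} {_≤_ : A → A → Set ℓ} {𝟏} →
                       IsSkewHilbert _≤_ f 𝟏 → IsSkewHilbert _≤_ g 𝟏
  isSkewHilbert-resp {_≤_ = _≤_} H = record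
    { isPartialOrder = isPartialOrder
    ; S1→ = λ {x} {y} x≤y → trans (sym (f≗g x y)) (S1→ x≤y)
    ; S1← = λ {x} {y} e → S1← (trans (f≗g x y) e)
    ; S2 = λ {x} {y} e →
        trans (sym (f≗g x (g (g x y) y)))
              (trans (cong (f x) (sym (nest x (y ∷ y ∷ []))))
                     (S2 (trans (f≗g y x) e)))
    ; S3 = λ {x} {y} z e →
        trans (sym (cong₂ g (f≗g y z) (f≗g x z)))
              (trans (sym (f≗g _ _)) (S3 z (trans (f≗g x y) e)))
    ; S4→ = λ x y w (below-ub , w≤x∘y) →
        S4→ x y w (below-ub , subst (w ≤_) (sym (f≗g x y)) w≤x∘y)
    ; S4← = λ x y w w≤y →
        let (below-ub , w≤x∘y) = S4← x y w w≤y
        in below-ub , subst (w ≤_) (f≗g x y) w≤x∘y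
    }
    where open IsSkewHilbert H

module OIAProperties {a : Level} {A : Set a} {_·_ : A → A → A} {𝟏 : A}
                     (isOIA : IsOIA _·_ 𝟏) where

  open IsOIA isOIA
  open FromOIA _·_ 𝟏 using (_∨_; _*_; _≤_)
  open ≡-Reasoning

  ·-identityˡ : ∀ x → 𝟏 · x ≡ x
  ·-identityˡ x = trans (cong (_· x) (sym (O1 x))) (O3 x x)

  *≗· : ∀ x y → x * y ≡ x · y
  *≗· x y = begin
    ((x · y) · y) · y         ≡⟨ O4 (x · y) y ⟩
    (y · (x · y)) · (x · y)   ≡⟨ cong (_· (x · y)) (O2 y x) ⟩
    𝟏 · (x · y)               ≡⟨ ·-identityˡ (x · y) ⟩
    x · y                     ∎

  x≤y⇒x∨y≡y : ∀ {x y} → x ≤ y → (x ∨ y) ≡ y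
  x≤y⇒x∨y≡y {y = y} x≤y = trans (cong (_· y) x≤y) (·-identityˡ y)

  ·-antitoneˡ : ∀ {x y} z → x ≤ y → (y · z) ≤ (x · z)
  ·-antitoneˡ {x} z x≤y =
    subst (λ t → (t · z) ≤ (x · z)) (x≤y⇒x∨y≡y x≤y) (O5 x _ z)

  ≤-trans : ∀ {x y z} → x ≤ y → y ≤ z → x ≤ z
  ≤-trans {x} {y} {z} x≤y y≤z = begin
    x · z             ≡⟨ sym (·-identityˡ (x · z)) ⟩
    𝟏 · (x · z)       ≡⟨ cong (_· (x · z)) (sym y≤z) ⟩
    (y · z) · (x · z) ≡⟨ ·-antitoneˡ z x≤y ⟩
    𝟏                 ∎

  ≤-antisym : ∀ {x y} → x ≤ y → y ≤ x → x ≡ y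
  ≤-antisym {x} {y} x≤y y≤x = begin
    x       ≡⟨ sym (x≤y⇒x∨y≡y y≤x) ⟩
    y ∨ x   ≡⟨ sym (O4 x y) ⟩
    x ∨ y   ≡⟨ x≤y⇒x∨y≡y x≤y ⟩
    y       ∎

  ≤-isPartialOrder : IsPartialOrder _≡_ _≤_
  ≤-isPartialOrder = record
    { isPreorder = record
      { isEquivalence = isEquivalence
      ; reflexive     = λ { refl → O1 _ }
      ; trans         = ≤-trans
      }
    ; antisym = ≤-antisym
    }

  y≤x·y : ∀ x y → y ≤ (x · y)
  y≤x·y x y = O2 y x

  x≤x∨y : ∀ x y → x ≤ (x ∨ y)
  x≤x∨y x y = trans (cong (x ·_) (O4 x y)) (O2 x (y · x))

  x≤x·y⇒x≤y : ∀ {x y} → x ≤ (x · y) → x ≤ y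
  x≤x·y⇒x≤y {x} {y} x≤x·y = begin
    x · y                   ≡⟨ sym (·-identityˡ (x · y)) ⟩
    𝟏 · (x · y)             ≡⟨ cong (_· (x · y)) (sym x≤x·y) ⟩
    (x · (x · y)) · (x · y) ≡⟨ O4 x (x · y) ⟩
    ((x · y) · x) · x       ≡⟨ cong (_· x) (O3 x y) ⟩
    x · x                   ≡⟨ O1 x ⟩
    𝟏                       ∎

  isSkewHilbert-· : IsSkewHilbert _≤_ _·_ 𝟏
  isSkewHilbert-· = record
    { isPartialOrder = ≤-isPartialOrder
    ; S1→ = λ x≤y → x≤y
    ; S1← = λ e → e
    ; S2  = λ {x} {y} _ → x≤x∨y x y
    ; S3  = ·-antitoneˡ
    ; S4→ = λ x y w (below-ub , w≤x·y) →
        x≤x·y⇒x≤y (≤-trans (below-ub (x ∨ y) (x≤x∨y x y , y≤x·y (x · y) y))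
                           (·-antitoneˡ y w≤x·y))
    ; S4← = λ x y w w≤y →
        (λ u (_ , y≤u) → ≤-trans w≤y y≤u) , ≤-trans w≤y (y≤x·y x y)
    }

  private
    ·≗* : ∀ x y → x · y ≡ x * y
    ·≗* x y = sym (*≗· x y)

  isSkewHilbert-* : IsSkewHilbert _≤_ _*_ 𝟏
  isSkewHilbert-* = isSkewHilbert-resp ·≗* isSkewHilbert-·

  condI-* : CondI _*_
  condI-* = condI-resp ·≗* O4

  condII-* : CondII _*_
  condII-* = condII-resp ·≗* O6

module SkewHilbertProperties {a ℓ : Level} {S : Set a} {_≤_ : S → S → Set ℓ}
                             {_*_ : S → S → S} {𝟏 : S}
                             (H : IsSkewHilbert _≤_ _*_ 𝟏) where

  open IsSkewHilbert H
  open IsPartialOrder isPartialOrder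
    using (antisym) renaming (refl to ≤-refl; trans to ≤-trans)

  y≤x*y : ∀ x y → y ≤ (x * y)
  y≤x*y x y = proj₂ (S4← x y y ≤-refl)

  x≤𝟏 : ∀ x → x ≤ 𝟏
  x≤𝟏 x = subst (x ≤_) (S1→ ≤-refl) (y≤x*y x x)

  modus-ponens : ∀ {w x y} → w ≤ x → w ≤ (x * y) → w ≤ y
  modus-ponens {w} {x} {y} w≤x w≤x*y =
    S4→ x y w ((λ u (x≤u , _) → ≤-trans w≤x x≤u) , w≤x*y)

  *-identityˡ : ∀ x → 𝟏 * x ≡ x
  *-identityˡ x = antisym (modus-ponens (x≤𝟏 (𝟏 * x)) ≤-refl) (y≤x*y 𝟏 x)

  *-antitoneˡ : ∀ {x y} z → x ≤ y → (y * z) ≤ (x * z)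
  *-antitoneˡ z x≤y = S1← (S3 z (S1→ x≤y))

  module WithCondI (condI : CondI _*_) where

    open FromSkew _*_ using (_∨_; _·_)

    x≤y⇒y∨x≡y : ∀ {x y} → x ≤ y → (y ∨ x) ≡ y
    x≤y⇒y∨x≡y {x} {y} x≤y =
      trans (condI y x) (trans (cong (_* y) (S1→ x≤y)) (*-identityˡ y))

    ∨-least : ∀ {x y u} → x ≤ u → y ≤ u → (x ∨ y) ≤ u
    ∨-least {y = y} x≤u y≤u =
      subst (_ ≤_) (x≤y⇒y∨x≡y y≤u) (*-antitoneˡ y (*-antitoneˡ y x≤u))

    ·≗* : ∀ x y → x · y ≡ x * y
    ·≗* x y = x≤y⇒y∨x≡y (y≤x*y x y)

    -- From u * y ≤ u and modus ponens, u * y = y; hence u = (u * y) * y = y * y = 𝟏.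
    x≤u⇒x*y≤u⇒u≡𝟏 : ∀ {x y u} → x ≤ u → (x * y) ≤ u → u ≡ 𝟏
    x≤u⇒x*y≤u⇒u≡𝟏 {x} {y} {u} x≤u x*y≤u = begin
      u             ≡⟨ sym (x≤y⇒y∨x≡y y≤u) ⟩
      (u * y) * y   ≡⟨ cong (_* y) u*y≡y ⟩
      y * y         ≡⟨ S1→ ≤-refl ⟩
      𝟏             ∎
      where
      open ≡-Reasoning
      y≤u : y ≤ u
      y≤u = ≤-trans (y≤x*y x y) x*y≤u
      u*y≤u : (u * y) ≤ u
      u*y≤u = ≤-trans (*-antitoneˡ y (∨-least x≤u y≤u))
                      (subst (_≤ u) (sym (·≗* x y)) x*y≤u)
      u*y≡y : u * y ≡ y
      u*y≡y = antisym (modus-ponens u*y≤u ≤-refl) (y≤x*y u y)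

    [x*y]*x≡x : ∀ x y → (x * y) * x ≡ x
    [x*y]*x≡x x y = antisym
      (S4→ (x * y) x ((x * y) * x)
        ( (λ u (x*y≤u , x≤u) →
             subst (_ ≤_) (sym (x≤u⇒x*y≤u⇒u≡𝟏 x≤u x*y≤u)) (x≤𝟏 _))
        , ≤-refl))
      (y≤x*y (x * y) x)

    isOIA-* : CondII _*_ → IsOIA _*_ 𝟏
    isOIA-* condII = record
      { O1 = λ x → S1→ ≤-refl
      ; O2 = λ x y → S1→ (y≤x*y y x)
      ; O3 = [x*y]*x≡x
      ; O4 = condI
      ; O5 = λ x y z →
          S3 z (S1→ (subst (x ≤_) (sym (condI x y)) (y≤x*y (y * x) x)))
      ; O6 = condII
      }

    isOIA-· : CondII _*_ → IsOIA _·_ 𝟏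
    isOIA-· condII = isOIA-resp (λ x y → sym (·≗* x y)) (isOIA-* condII)

mainTheorem2 : ∀ {a ℓ : Level} →
    (∀ {A : Set a} (_·_ : A → A → A) (𝟏 : A) → IsOIA _·_ 𝟏 →
      IsSkewHilbert (FromOIA._≤_ _·_ 𝟏) (FromOIA._*_ _·_ 𝟏) 𝟏
        × CondI (FromOIA._*_ _·_ 𝟏) × CondII (FromOIA._*_ _·_ 𝟏))
    × (∀ {S : Set a} (_≤_ : S → S → Set ℓ) (_*_ : S → S → S) (𝟏 : S) →
      IsSkewHilbert _≤_ _*_ 𝟏 → CondI _*_ → CondII _*_ →
      IsOIA (FromSkew._·_ _*_) 𝟏)
mainTheorem2 =
    (λ _·_ 𝟏 isOIA → let open OIAProperties isOIA in
                      isSkewHilbert-* , condI-* , condII-*)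
  , (λ _≤_ _*_ 𝟏 H condI condII →
       SkewHilbertProperties.WithCondI.isOIA-· H condI condII)
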